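{- In the generalized Zeckendorf game with $p\ge 4$ players on any $n\ge 16$, no player has a winning strategy.
   Context: Let $a_1=1$, $a_2=2$ and $a_{i+1}=i\,a_i+a_{i-1}$ for $i\ge 2$. The generalized Zeckendorf game on $n$: the state is a multiset of terms of the sequence, initially $n$ copies of $a_1=1$. A move is one of: (combining) replace two $1$'s by one $2$; or, for $i\ge 2$, if the multiset contains at least $i$ copies of $a_i$ and at least one $a_{i-1}$, replace $i$ copies of $a_i$ and one $a_{i-1}$ by one $a_{i+1}$; (splitting) if it contains three $2$'s, replace them by one $1$ and one $5$; or, for $i\ge 3$, if it contains $i+1$ copies of $a_i$, replace them by one $a_{i+1}$, $i-2$ copies of $a_{i-1}$ and one $a_{i-2}$. Players $1,2,\dots,p$ move in cyclic order (player 1 first) until no move is available; the player making the last move wins. A player has a winning strategy if that player can guarantee making the last move regardless of the moves of all other players. -}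

module Defs where

open import Data.Nat using (ℕ; zero; suc; _+_; _∸_; _≤_; _≟_)
open import Data.Product using (Σ; ∃; _,_)
open import Relation.Nullary using (¬_; yes; no)
open import Relation.Binary.PropositionalEquality using (_≡_; _≢_)

-- The sequence a₁ = 1, a₂ = 2, a_{i+1} = i a_i + a_{i-1}.  Its terms are
-- strictly increasing (1, 2, 5, 17, ...), hence distinct, so a multiset of
-- terms is the same as a count for each index.
a : ℕ → ℕ
a zero = 0              -- unused (indices start at 1)
a (suc zero) = 1
a (suc (suc zero)) = 2
a (suc (suc (suc i))) = suc (suc i) * a (suc (suc i)) + a (suc i)
  where open import Data.Nat using (_*_)

-- A game state: s i = number of copies of a_i in the multiset (i ≥ 1;
-- index 0 is never used and stays 0).
State : Set
State = ℕ → ℕ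

single : ℕ → ℕ → State
single i c j with j ≟ i
... | yes _ = c
... | no _ = 0

_⊕_ : State → State → State
(s ⊕ t) j = s j + t j
infixl 6 _⊕_

Step : State → State → State → State → Set
Step rem add s s' = (∀ j → rem j ≤ s j) × (∀ j → s' j ≡ (s j ∸ rem j) + add j)
  where open import Data.Product using (_×_)

data Move (s s' : State) : Set where
  combine1 : Step (single 1 2) (single 2 1) s s' → Move s s'
  combine  : (i : ℕ) → 2 ≤ i →
             Step (single i i ⊕ single (i ∸ 1) 1) (single (suc i) 1) s s' → Move s s'
  split2   : Step (single 2 3) (single 1 1 ⊕ single 3 1) s s' → Move s s'
  split    : (i : ℕ) → 3 ≤ i →
             Step (single i (suc i))
                  (single (suc i) 1 ⊕ single (i ∸ 1) (i ∸ 2) ⊕ single (i ∸ 2) 1) s s' → Move s s'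

Terminal : State → Set
Terminal s = ¬ (∃ λ s' → Move s s')

initial : ℕ → State
initial n = single 1 n

-- Players are numbered 0, …, p-1 (paper's player 1 is 0); cyclic successor.
next : ℕ → ℕ → ℕ
next p j with suc j ≟ p
... | yes _ = 0
... | no _ = suc j

-- Forces p k s j : in the p-player game at state s with player j to move,
-- player k can guarantee making the last move, whatever the others do.
data Forces (p k : ℕ) : State → ℕ → Set where
  -- no move available; the last move was made by k (k is the player just before j)
  done   : ∀ {s j} → Terminal s → next p k ≡ j → Forces p k s j
  mine   : ∀ {s s' j} → j ≡ k → Move s s' → Forces p k s' (next p j) → Forces p k s j
  theirs : ∀ {s j} → j ≢ k → (∃ λ s' → Move s s') →
           (∀ s' → Move s s' → Forces p k s' (next p j)) → Forces p k s j

HasWinningStrategy : ℕ → ℕ → ℕ → Set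
HasWinningStrategy p n k = Forces p k (initial n) 0

{-# OPTIONS --safe #-}
module Submission where

open import Defs
open import Data.Nat using (ℕ; _≤_; _<_; zero; suc; _+_; _∸_; z≤n; s≤s; _≟_)
open import Data.Nat.Properties
  using (+-identityʳ; +-comm; m+[n∸m]≡n; suc-injective; 1+n≢n; m+n≤o⇒m≤o; ≤-trans; <⇒≱)
open import Data.Product using (∃; _,_; _×_; proj₁)
open import Data.Empty using (⊥-elim)
open import Relation.Nullary using (¬_; yes; no)
open import Relation.Binary.PropositionalEquality
  using (_≡_; _≢_; _≗_; refl; sym; trans; cong; subst)

-- Two move sequences by players other than k from the same position, one of
-- length 1 and one of length 2, reach the same state: then k would have to
-- force a win from that state both on some player's turn and on the next
-- player's turn, which is impossible since at most one player can force a win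
-- from a given position.  From 16 ones the first two moves are forced, and a
-- short case analysis on k (with one extra branch when p = 4) always finds
-- such a transposition among the other players' moves.

next-injective : ∀ {p j k} → next p j ≡ next p k → j ≡ k
next-injective {p} {j} {k} eq with suc j ≟ p | suc k ≟ p
... | yes j+1≡p | yes k+1≡p = suc-injective (trans j+1≡p (sym k+1≡p))
... | yes _     | no _      with () ← eq
... | no _      | yes _     with () ← eq
... | no _      | no _      = suc-injective eq

next≢id : ∀ {p k} → 2 ≤ p → next p k ≢ k
next≢id {p} {k} 2≤p with suc k ≟ p
next≢id {k = zero}  (s≤s (s≤s _)) | yes ()
next≢id {k = suc k} _             | yes _ = λ ()
... | no _ = 1+n≢n

next≢suc : ∀ {p j i} → j ≢ i → next p j ≢ suc i
next≢suc {p} {j} j≢i with suc j ≟ p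
... | yes _ = λ ()
... | no _  = λ eq → j≢i (suc-injective eq)

Step-respˡ : ∀ {r a s t s′} → s ≗ t → Step r a s s′ → Step r a t s′
Step-respˡ {r} {a} s≗t (r≤s , s′≡) =
  (λ j → subst (r j ≤_) (s≗t j) (r≤s j)) ,
  (λ j → trans (s′≡ j) (cong (λ v → v ∸ r j + a j) (s≗t j)))

Step-deterministic : ∀ {r a s s₁ s₂} → Step r a s s₁ → Step r a s s₂ → s₁ ≗ s₂
Step-deterministic (_ , s₁≡) (_ , s₂≡) j = trans (s₁≡ j) (sym (s₂≡ j))

Move-respˡ : ∀ {s t s′} → s ≗ t → Move s s′ → Move t s′
Move-respˡ s≗t (combine1 stp)       = combine1 (Step-respˡ s≗t stp)
Move-respˡ s≗t (combine i i≥2 stp)  = combine i i≥2 (Step-respˡ s≗t stp)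
Move-respˡ s≗t (split2 stp)         = split2 (Step-respˡ s≗t stp)
Move-respˡ s≗t (split i i≥3 stp)    = split i i≥3 (Step-respˡ s≗t stp)

Forces-resp : ∀ {p k s t j} → s ≗ t → Forces p k s j → Forces p k t j
Forces-resp s≗t (done term k→j) =
  done (λ { (s′ , m) → term (s′ , Move-respˡ (λ i → sym (s≗t i)) m) }) k→j
Forces-resp s≗t (mine j≡k m f) = mine j≡k (Move-respˡ s≗t m) f
Forces-resp s≗t (theirs j≢k (s′ , m) g) =
  theirs j≢k (s′ , Move-respˡ s≗t m) (λ s″ m′ → g s″ (Move-respˡ (λ i → sym (s≗t i)) m′))

Forces-others : ∀ {p k s s′ j} → Forces p k s j → j ≢ k → Move s s′ →
                Forces p k s′ (next p j)
Forces-others (done term _)  _   m = ⊥-elim (term (_ , m))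
Forces-others (mine j≡k _ _) j≢k _ = ⊥-elim (j≢k j≡k)
Forces-others (theirs _ _ g) _   m = g _ m

Forces-own : ∀ {p k s s₀} → Forces p k s k → Move s s₀ →
             ∃ λ s′ → Move s s′ × Forces p k s′ (next p k)
Forces-own (done term _)    m = ⊥-elim (term (_ , m))
Forces-own (mine _ m′ f)    _ = _ , m′ , f
Forces-own (theirs k≢k _ _) _ = ⊥-elim (k≢k refl)

Forces-forced : ∀ {p k s t j} → (∀ {s′} → Move s s′ → s′ ≗ t) → Move s t →
                Forces p k s j → Forces p k t (next p j)
Forces-forced _    m (done term _)  = ⊥-elim (term (_ , m))
Forces-forced only _ (mine _ m′ f)  = Forces-resp (only m′) f
Forces-forced _    m (theirs _ _ g) = g _ m

Forces-unique : ∀ {p k k′ s j} → Forces p k s j → Forces p k′ s j → k ≡ k′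
Forces-unique (done _ k→j)     (done _ k′→j)     = next-injective (trans k→j (sym k′→j))
Forces-unique (done term _)    (mine _ m _)      = ⊥-elim (term (_ , m))
Forces-unique (done term _)    (theirs _ m _)    = ⊥-elim (term m)
Forces-unique (mine _ m _)     (done term _)     = ⊥-elim (term (_ , m))
Forces-unique (mine j≡k _ _)   (mine j≡k′ _ _)   = trans (sym j≡k) j≡k′
Forces-unique (mine _ m f)     (theirs _ _ g)    = Forces-unique f (g _ m)
Forces-unique (theirs _ m _)   (done term _)     = ⊥-elim (term m)
Forces-unique (theirs _ _ g)   (mine _ m f)      = Forces-unique (g _ m) f
Forces-unique (theirs _ (s′ , m) g) (theirs _ _ g′) = Forces-unique (g s′ m) (g′ s′ m)

Forces-rotate : ∀ {p k s j} → Forces p k s j → Forces p (next p k) s (next p j)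
Forces-rotate (done term k→j) = done term (cong _ k→j)
Forces-rotate (mine j≡k m f)  = mine (cong _ j≡k) m (Forces-rotate f)
Forces-rotate (theirs j≢k m g) =
  theirs (λ eq → j≢k (next-injective eq)) m (λ s′ m′ → Forces-rotate (g s′ m′))

¬Forces-consecutive : ∀ {p k s j} → 2 ≤ p →
                      Forces p k s j → ¬ Forces p k s (next p j)
¬Forces-consecutive 2≤p f f′ = next≢id 2≤p (Forces-unique (Forces-rotate f) f′)

¬Forces-transposition : ∀ {p k s t u j} → 2 ≤ p → j ≢ k → next p j ≢ k →
                        Move s t → Move s u → Move u t → ¬ Forces p k s j
¬Forces-transposition 2≤p j≢k j′≢k s→t s→u u→t f =
  ¬Forces-consecutive 2≤p
    (Forces-others f j≢k s→t)
    (Forces-others (Forces-others f j≢k s→u) j′≢k u→t)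

-- ⟨ x , y , z ⟩ holds x ones, y twos and z fives (a₁, a₂, a₃).
⟨_,_,_⟩ : ℕ → ℕ → ℕ → State
⟨ x , y , z ⟩ (suc zero)             = x
⟨ x , y , z ⟩ (suc (suc zero))       = y
⟨ x , y , z ⟩ (suc (suc (suc zero))) = z
⟨ x , y , z ⟩ _                      = 0

initial≗ : ∀ n → initial n ≗ ⟨ n , 0 , 0 ⟩
initial≗ n zero                         = refl
initial≗ n (suc zero)                   = refl
initial≗ n (suc (suc zero))             = refl
initial≗ n (suc (suc (suc zero)))       = refl
initial≗ n (suc (suc (suc (suc _))))    = refl

combine1-step : ∀ x y z →
  Step (single 1 2) (single 2 1) ⟨ 2 + x , y , z ⟩ ⟨ x , 1 + y , z ⟩
combine1-step x y z = fits , result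
  where
  fits : ∀ j → single 1 2 j ≤ ⟨ 2 + x , y , z ⟩ j
  fits (suc zero)                      = s≤s (s≤s z≤n)
  fits zero                            = z≤n
  fits (suc (suc zero))                = z≤n
  fits (suc (suc (suc zero)))          = z≤n
  fits (suc (suc (suc (suc _))))       = z≤n
  result : ∀ j → ⟨ x , 1 + y , z ⟩ j ≡ (⟨ 2 + x , y , z ⟩ j ∸ single 1 2 j) + single 2 1 j
  result zero                          = refl
  result (suc zero)                    = sym (+-identityʳ x)
  result (suc (suc zero))              = +-comm 1 y
  result (suc (suc (suc zero)))        = sym (+-identityʳ z)
  result (suc (suc (suc (suc _))))     = refl

combine2-step : ∀ x y z →
  Step (single 2 2 ⊕ single 1 1) (single 3 1) ⟨ 1 + x , 2 + y , z ⟩ ⟨ x , y , 1 + z ⟩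
combine2-step x y z = fits , result
  where
  fits : ∀ j → (single 2 2 ⊕ single 1 1) j ≤ ⟨ 1 + x , 2 + y , z ⟩ j
  fits (suc zero)                      = s≤s z≤n
  fits (suc (suc zero))                = s≤s (s≤s z≤n)
  fits zero                            = z≤n
  fits (suc (suc (suc zero)))          = z≤n
  fits (suc (suc (suc (suc _))))       = z≤n
  result : ∀ j → ⟨ x , y , 1 + z ⟩ j ≡
                 (⟨ 1 + x , 2 + y , z ⟩ j ∸ (single 2 2 ⊕ single 1 1) j) + single 3 1 j
  result zero                          = refl
  result (suc zero)                    = sym (+-identityʳ x)
  result (suc (suc zero))              = sym (+-identityʳ y)
  result (suc (suc (suc zero)))        = +-comm 1 z
  result (suc (suc (suc (suc _))))     = refl

split2-step : ∀ x y z →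
  Step (single 2 3) (single 1 1 ⊕ single 3 1) ⟨ x , 3 + y , z ⟩ ⟨ 1 + x , y , 1 + z ⟩
split2-step x y z = fits , result
  where
  fits : ∀ j → single 2 3 j ≤ ⟨ x , 3 + y , z ⟩ j
  fits (suc (suc zero))                = s≤s (s≤s (s≤s z≤n))
  fits zero                            = z≤n
  fits (suc zero)                      = z≤n
  fits (suc (suc (suc zero)))          = z≤n
  fits (suc (suc (suc (suc _))))       = z≤n
  result : ∀ j → ⟨ 1 + x , y , 1 + z ⟩ j ≡
                 (⟨ x , 3 + y , z ⟩ j ∸ single 2 3 j) + (single 1 1 ⊕ single 3 1) j
  result zero                          = refl
  result (suc zero)                    = +-comm 1 x
  result (suc (suc zero))              = sym (+-identityʳ y)
  result (suc (suc (suc zero)))        = +-comm 1 z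
  result (suc (suc (suc (suc _))))     = refl

combine1-move : ∀ x y z → Move ⟨ 2 + x , y , z ⟩ ⟨ x , 1 + y , z ⟩
combine1-move x y z = combine1 (combine1-step x y z)

combine2-move : ∀ x y z → Move ⟨ 1 + x , 2 + y , z ⟩ ⟨ x , y , 1 + z ⟩
combine2-move x y z = combine 2 (s≤s (s≤s z≤n)) (combine2-step x y z)

split2-move : ∀ x y z → Move ⟨ x , 3 + y , z ⟩ ⟨ 1 + x , y , 1 + z ⟩
split2-move x y z = split2 (split2-step x y z)

single-self : ∀ i c → single i c i ≡ c
single-self i c with i ≟ i
... | yes _   = refl
... | no i≢i = ⊥-elim (i≢i refl)

single-self-≰0 : ∀ i c → ¬ single i (suc c) i ≤ 0
single-self-≰0 i c le with () ← subst (_≤ 0) (single-self i (suc c)) le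

data SmallMove (x y z : ℕ) (s′ : State) : Set where
  by-combine1 : s′ ≗ ⟨ x ∸ 2 , 1 + y , z ⟩ → SmallMove x y z s′
  by-combine2 : 2 ≤ y → s′ ≗ ⟨ x ∸ 1 , y ∸ 2 , 1 + z ⟩ → SmallMove x y z s′
  by-split2   : 3 ≤ y → s′ ≗ ⟨ 1 + x , y ∸ 3 , 1 + z ⟩ → SmallMove x y z s′

-- With fewer than three fives, no a₃ can be combined or split, and larger
-- terms are absent.
small-move : ∀ {x y z s′} → z < 3 → Move ⟨ x , y , z ⟩ s′ → SmallMove x y z s′
small-move _ (combine1 stp) with proj₁ stp 1
... | s≤s (s≤s _) = by-combine1 (Step-deterministic stp (combine1-step _ _ _))
small-move _ (combine 1 (s≤s ()) _)
small-move _ (combine 2 _ stp) with proj₁ stp 1 | proj₁ stp 2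
... | s≤s _ | 2≤y@(s≤s (s≤s _)) =
  by-combine2 2≤y (Step-deterministic stp (combine2-step _ _ _))
small-move z<3 (combine 3 _ stp) = ⊥-elim (<⇒≱ z<3 (m+n≤o⇒m≤o 3 (proj₁ stp 3)))
small-move _ (combine (suc (suc (suc (suc i)))) _ stp) =
  ⊥-elim (single-self-≰0 (4 + i) (3 + i) (m+n≤o⇒m≤o _ (proj₁ stp (4 + i))))
small-move _ (split2 stp) with proj₁ stp 2
... | 3≤y@(s≤s (s≤s (s≤s _))) = by-split2 3≤y (Step-deterministic stp (split2-step _ _ _))
small-move _ (split 1 (s≤s ()) _)
small-move _ (split 2 (s≤s (s≤s ())) _)
small-move z<3 (split 3 _ stp) =
  ⊥-elim (<⇒≱ z<3 (≤-trans (s≤s (s≤s (s≤s z≤n))) (m+n≤o⇒m≤o 4 (proj₁ stp 3))))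
small-move _ (split (suc (suc (suc (suc i)))) _ stp) =
  ⊥-elim (single-self-≰0 (4 + i) (4 + i) (proj₁ stp (4 + i)))

only-combine1 : ∀ {x y z s′} → y < 2 → z < 3 →
                Move ⟨ 2 + x , y , z ⟩ s′ → s′ ≗ ⟨ x , 1 + y , z ⟩
only-combine1 y<2 z<3 m with small-move z<3 m
... | by-combine1 eq     = eq
... | by-combine2 2≤y _  = ⊥-elim (<⇒≱ y<2 2≤y)
... | by-split2   3≤y _  = ⊥-elim (<⇒≱ y<2 (≤-trans (s≤s (s≤s z≤n)) 3≤y))

Forces-combine1 : ∀ {p k x y z j} → y < 2 → z < 3 →
                  Forces p k ⟨ 2 + x , y , z ⟩ j → Forces p k ⟨ x , 1 + y , z ⟩ (next p j)
Forces-combine1 y<2 z<3 = Forces-forced (only-combine1 y<2 z<3) (combine1-move _ _ _)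

-- combine2 reaches in one move what combine1 followed by split2 reaches in two.
¬Forces-two-others : ∀ {p k x y z j} → 2 ≤ p → j ≢ k → next p j ≢ k →
                     ¬ Forces p k ⟨ 2 + x , 2 + y , z ⟩ j
¬Forces-two-others {x = x} {y} {z} 2≤p j≢k j′≢k =
  ¬Forces-transposition 2≤p j≢k j′≢k
    (combine2-move (1 + x) y z) (combine1-move x (2 + y) z) (split2-move x y z)

¬Forces-three-others : ∀ {p k x y z j} → 2 ≤ p → j ≢ k → next p j ≢ k →
                       next p (next p j) ≢ k → ¬ Forces p k ⟨ 4 + x , 1 + y , z ⟩ j
¬Forces-three-others {x = x} {y} {z} 2≤p j≢k j′≢k j″≢k f =
  ¬Forces-two-others 2≤p j′≢k j″≢k (Forces-others f j≢k (combine1-move (2 + x) (1 + y) z))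

2≤4+q : ∀ {q} → 2 ≤ 4 + q
2≤4+q = s≤s (s≤s z≤n)

¬Forces-player3 : ∀ q m → ¬ Forces (4 + q) 3 ⟨ 12 + m , 2 , 0 ⟩ 2
¬Forces-player3 q m f =
  ¬Forces-three-others 2≤4+q
    (next≢id 2≤4+q) (next≢suc (next≢suc λ ())) (next≢suc (next≢suc (next≢suc λ ())))
    (Forces-combine1 (s≤s z≤n) (s≤s (s≤s z≤n))
      (Forces-others f (λ ()) (combine2-move (11 + m) 0 0)))

¬Forces-four-players : ∀ m → ¬ Forces 4 2 ⟨ 7 + m , 2 , 1 ⟩ 1
¬Forces-four-players m f
  with Forces-own (Forces-others f (λ ()) (combine1-move (5 + m) 2 1)) (combine1-move (3 + m) 3 1)
... | s′ , m′ , f′ with small-move (s≤s (s≤s z≤n)) m′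
...   | by-combine1 eq   = ¬Forces-two-others 2≤4+q (λ ()) (λ ()) (Forces-resp eq f′)
...   | by-combine2 _ eq = ¬Forces-three-others 2≤4+q (λ ()) (λ ()) (λ ()) (Forces-resp eq f′)
...   | by-split2 _ eq   =
  ¬Forces-consecutive 2≤4+q (Forces-others f (λ ()) (combine2-move (6 + m) 0 1)) (Forces-resp eq f′)

-- With five or more players the next three moves are all by others; with
-- four, player 2 moves again within them.
¬Forces-player2-late : ∀ q m → ¬ Forces (4 + q) 2 ⟨ 9 + m , 1 , 1 ⟩ (next (4 + q) 3)
¬Forces-player2-late (suc q) m =
  ¬Forces-three-others 2≤4+q (λ ()) (next≢suc λ ()) (next≢suc (next≢suc λ ()))
¬Forces-player2-late zero m f =
  ¬Forces-four-players m (Forces-combine1 (s≤s (s≤s z≤n)) (s≤s (s≤s z≤n)) f)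

¬Forces-player2 : ∀ q m → ¬ Forces (4 + q) 2 ⟨ 12 + m , 2 , 0 ⟩ 2
¬Forces-player2 q m f with Forces-own f (combine1-move (10 + m) 2 0)
... | s′ , m′ , f′ with small-move (s≤s z≤n) m′
...   | by-combine1 eq   = ¬Forces-two-others 2≤4+q (λ ()) (next≢suc λ ()) (Forces-resp eq f′)
...   | by-combine2 _ eq =
  ¬Forces-player2-late q m (Forces-combine1 (s≤s z≤n) (s≤s (s≤s z≤n)) (Forces-resp eq f′))
...   | by-split2 3≤2 _  = ⊥-elim (<⇒≱ (s≤s (s≤s (s≤s z≤n))) 3≤2)

¬Forces-after-opening : ∀ q m k → ¬ Forces (4 + q) k ⟨ 12 + m , 2 , 0 ⟩ 2
¬Forces-after-opening q m 2 = ¬Forces-player2 q m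
¬Forces-after-opening q m 3 = ¬Forces-player3 q m
¬Forces-after-opening q m 0 = ¬Forces-two-others 2≤4+q (λ ()) (λ ())
¬Forces-after-opening q m 1 = ¬Forces-two-others 2≤4+q (λ ()) (λ ())
¬Forces-after-opening q m (suc (suc (suc (suc k)))) = ¬Forces-two-others 2≤4+q (λ ()) (λ ())

theorem7p1 : (p n : ℕ) → 4 ≤ p → 16 ≤ n →
    (k : ℕ) → k < p → ¬ HasWinningStrategy p n k
theorem7p1 (suc (suc (suc (suc q)))) n (s≤s (s≤s (s≤s (s≤s z≤n)))) 16≤n k _ wins =
  ¬Forces-after-opening q (n ∸ 16) k
    (Forces-combine1 (s≤s (s≤s z≤n)) (s≤s z≤n)
      (Forces-combine1 (s≤s z≤n) (s≤s z≤n) (Forces-resp initial≗16+m wins)))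
  where
  initial≗16+m : initial n ≗ ⟨ 16 + (n ∸ 16) , 0 , 0 ⟩
  initial≗16+m j =
    trans (initial≗ n j) (cong (λ v → ⟨ v , 0 , 0 ⟩ j) (sym (m+[n∸m]≡n 16≤n)))
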